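{- For a rational number $a$ and an integer $n \ge 1$, let $K_{a,n}(x) = x^n + (1-x)^n + a^n \in \mathbb{Q}[x]$. Then the following are equivalent: (i) there exist a rational number $a \neq -1$ and a positive integer $n$ such that $K_{a,n}$ has a rational root; (ii) there exist an integer $m > 2$ and integers $X, Y, Z$ with $XYZ \neq 0$ such that $X^m + Y^m = Z^m$. -}

module Defs where

open import Data.Nat using (ℕ; zero; suc)
open import Data.Rational using (ℚ; 1ℚ; _+_; _-_; _*_)

infixr 8 _^ℚ_
_^ℚ_ : ℚ → ℕ → ℚ
q ^ℚ zero  = 1ℚ
q ^ℚ suc n = q * (q ^ℚ n)

K : ℚ → ℕ → ℚ → ℚ
K a n x = (x ^ℚ n) + ((1ℚ - x) ^ℚ n) + (a ^ℚ n)

module Submission where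

-- Clearing denominators, x = A/(A + B) and a = C/(A + B) turn a root x of K_{a,n} with a ≠ −1
-- into integers with A^n + B^n + C^n = 0, A + B ≠ 0 and A + B + C ≠ 0, and back. For even n
-- such integers would vanish, for n = 1 the sum A + B + C would vanish, and for odd n ≥ 3 they
-- give the Fermat solution A^n + B^n = (−C)^n. Conversely a Fermat exponent m > 2 is divisible
-- either by 4, which Fermat's descent for x⁴ + y⁴ = z² excludes, or by an odd p ≥ 3; then
-- U^p + V^p = W^p yields (U, V, −W), and W ≠ U + V since U^p + V^p < (U + V)^p when U, V have
-- the same sign (the other sign patterns reduce to this one).

module FermatQuartic where
  open import Data.Nat
  open import Data.Nat.Properties
  open import Data.Nat.Divisibility
  open import Data.Nat.Coprimality using (Coprime; coprime-divisor; coprime-factors; gcd≡1⇒coprime)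
    renaming (sym to coprime-sym)
  open import Data.Nat.GCD
  open import Data.Nat.Induction using (<-rec)
  open import Data.Nat.Tactic.RingSolver using (solve-∀)
  open import Data.Product using (∃-syntax; _×_; _,_; proj₁; proj₂)
  open import Data.Sum using (_⊎_; inj₁; inj₂)
  open import Relation.Nullary using (¬_; contradiction)
  open import Relation.Binary.PropositionalEquality

  Even Odd : ℕ → Set
  Even n = ∃[ k ] n ≡ 2 * k
  Odd  n = ∃[ k ] n ≡ 1 + 2 * k

  even-or-odd : ∀ n → Even n ⊎ Odd n
  even-or-odd zero = inj₁ (0 , refl)
  even-or-odd (suc n) with even-or-odd n
  ... | inj₁ (k , refl) = inj₂ (k , refl)
  ... | inj₂ (k , refl) = inj₁ (suc k , cong suc (sym (+-suc k (k + 0))))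

  even⇒¬odd : ∀ {n} → Even n → ¬ Odd n
  even⇒¬odd (k , refl) (l , eq) = even≢odd k l eq

  infix 8 _²
  _² : ℕ → ℕ
  n ² = n * n

  [m*n]²≡m²*n² : ∀ m n → (m * n) ² ≡ m ² * n ²
  [m*n]²≡m²*n² m n = [m*n]*[o*p]≡[m*o]*[n*p] m n m n

  [2*n]²≡4*n² : ∀ n → (2 * n) ² ≡ 4 * n ²
  [2*n]²≡4*n² = [m*n]²≡m²*n² 2

  even² : ∀ {n} → Even n → Even (n ²)
  even² (k , refl) = k * (2 * k) , *-assoc 2 k (2 * k)

  odd² : ∀ {n} → Odd n → Odd (n ²)
  odd² (k , refl) = 2 * k * k + 2 * k , identity k
    where
    identity : ∀ k → (1 + 2 * k) * (1 + 2 * k) ≡ 1 + 2 * (2 * k * k + 2 * k)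
    identity = solve-∀

  odd²⇒odd : ∀ {n} → Odd (n ²) → Odd n
  odd²⇒odd {n} n²-odd with even-or-odd n
  ... | inj₁ n-even = contradiction n²-odd (even⇒¬odd (even² n-even))
  ... | inj₂ n-odd  = n-odd

  odd+even : ∀ {m n} → Odd m → Even n → Odd (m + n)
  odd+even (k , refl) (l , refl) = k + l , identity k l
    where
    identity : ∀ k l → 1 + 2 * k + 2 * l ≡ 1 + 2 * (k + l)
    identity = solve-∀

  odd²+odd² : ∀ {a b} → Odd a → Odd b → ∃[ t ] a ² + b ² ≡ 2 * (1 + 2 * t)
  odd²+odd² (i , refl) (j , refl) = i * i + i + j * j + j , identity i j
    where
    identity : ∀ i j → (1 + 2 * i) * (1 + 2 * i) + (1 + 2 * j) * (1 + 2 * j)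
                     ≡ 2 * (1 + 2 * (i * i + i + j * j + j))
    identity = solve-∀

  odd²+odd²≢² : ∀ {a b c} → Odd a → Odd b → a ² + b ² ≢ c ²
  odd²+odd²≢² {c = c} a-odd b-odd eq with odd²+odd² a-odd b-odd | even-or-odd c
  ... | t , sum | inj₁ (l , refl) =
    even≢odd (l * l) t (*-cancelˡ-≡ _ _ 2 (trans (sym (identity l)) (trans (sym eq) sum)))
    where
    identity : ∀ l → 2 * l * (2 * l) ≡ 2 * (2 * (l * l))
    identity = solve-∀
  ... | t , sum | inj₂ c-odd = even⇒¬odd (1 + 2 * t , trans (sym eq) sum) (odd² c-odd)

  ²-mono-< : ∀ {m n} → m < n → m ² < n ²
  ²-mono-< m<n = *-mono-< m<n m<n

  ²-cancel-≤ : ∀ {m n} → m ² ≤ n ² → m ≤ n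
  ²-cancel-≤ m²≤n² = ≮⇒≥ (λ n<m → <⇒≱ (²-mono-< n<m) m²≤n²)

  ²-cancel-< : ∀ {m n} → m ² < n ² → m < n
  ²-cancel-< m²<n² = ≰⇒> (λ n≤m → <⇒≱ m²<n² (*-mono-≤ n≤m n≤m))

  ²-injective : ∀ {m n} → m ² ≡ n ² → m ≡ n
  ²-injective eq = ≤-antisym (²-cancel-≤ (≤-reflexive eq)) (²-cancel-≤ (≤-reflexive (sym eq)))

  n≤n² : ∀ n → n ≤ n ²
  n≤n² zero    = z≤n
  n≤n² (suc n) = m≤m*n (suc n) (suc n)

  *-positive⇒positive : ∀ {m n} → 0 < m * n → 0 < m × 0 < n
  *-positive⇒positive {m} {n} mn>0 =
    >-nonZero⁻¹ m {{m*n≢0⇒m≢0 m {{>-nonZero mn>0}}}} , >-nonZero⁻¹ n {{m*n≢0⇒n≢0 m {{>-nonZero mn>0}}}}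

  coprime-∣ : ∀ {m n u v} → Coprime m n → u ∣ m → v ∣ n → Coprime u v
  coprime-∣ cop u∣m v∣n (d∣u , d∣v) = cop (∣-trans d∣u u∣m , ∣-trans d∣v v∣n)

  coprime-²ˡ : ∀ {m n} → Coprime m n → Coprime (m ²) n
  coprime-²ˡ {m} cop (d∣m² , d∣n) = cop (coprime-factors (coprime-sym cop) (∣m⇒∣m*n m d∣n , d∣m²) , d∣n)

  coprime-² : ∀ {m n} → Coprime m n → Coprime (m ²) (n ²)
  coprime-² cop = coprime-sym (coprime-²ˡ (coprime-sym (coprime-²ˡ cop)))

  IsSquare : ℕ → Set
  IsSquare n = ∃[ t ] n ≡ t ²

  -- The square root of u is gcd u w.
  coprime*≡²⇒squareˡ : ∀ {u v w} → Coprime u v → u * v ≡ w ² → IsSquare u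
  coprime*≡²⇒squareˡ {u} {v} {w} cop uv≡w² = g , ∣-antisym u∣g² g²∣u
    where
    g = gcd u w
    u∣w² : u ∣ w * w
    u∣w² = subst (u ∣_) uv≡w² (m∣m*n v)
    u∣gw : u ∣ g * w
    u∣gw = subst (u ∣_) (trans (sym (c*gcd[m,n]≡gcd[cm,cn] w u w)) (*-comm w g)) (gcd-greatest (n∣m*n w) u∣w²)
    u∣g² : u ∣ g * g
    u∣g² = subst (u ∣_) (sym (c*gcd[m,n]≡gcd[cm,cn] g u w)) (gcd-greatest (n∣m*n g) u∣gw)
    g²∣u : g * g ∣ u
    g²∣u = coprime-divisor (coprime-²ˡ (coprime-∣ cop (gcd[m,n]∣m u w) ∣-refl))
             (subst (g * g ∣_) (trans (sym uv≡w²) (*-comm u v)) (*-pres-∣ (gcd[m,n]∣n u w) (gcd[m,n]∣n u w)))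

  coprime*≡²⇒squares : ∀ {u v w} → Coprime u v → u * v ≡ w ² → IsSquare u × IsSquare v
  coprime*≡²⇒squares {u} {v} {w} cop uv≡w² =
    coprime*≡²⇒squareˡ {w = w} cop uv≡w² ,
    coprime*≡²⇒squareˡ {w = w} (coprime-sym cop) (trans (*-comm v u) uv≡w²)

  ²∣²⇒∣ : ∀ {m n} → m ² ∣ n ² → m ∣ n
  ²∣²⇒∣ {zero} {n} 0∣n² with m*n≡0⇒m≡0∨n≡0 n (0∣⇒≡0 0∣n²)
  ... | inj₁ refl = ∣-refl
  ... | inj₂ refl = ∣-refl
  ²∣²⇒∣ {m@(suc _)} {n} m²∣n² with gcd[m,n]∣m m n | gcd[m,n]∣n m n
  ... | divides m′ m≡m′g | divides n′ n≡n′g = subst (_∣ n) (sym m≡g) (gcd[m,n]∣n m n)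
    where
    g = gcd m n
    instance
      g≢0 : NonZero g
      g≢0 = ≢-nonZero (gcd[m,n]≢0 m n (inj₁ λ ()))
    cop : Coprime m′ n′
    cop {d} (d∣m′ , d∣n′) = ∣1⇒≡1 (*-cancelʳ-∣ g (subst (d * g ∣_) (sym (*-identityˡ g))
      (gcd-greatest (subst (d * g ∣_) (sym m≡m′g) (*-monoˡ-∣ g d∣m′))
                    (subst (d * g ∣_) (sym n≡n′g) (*-monoˡ-∣ g d∣n′)))))
    m′²∣n′² : m′ ² ∣ n′ ²
    m′²∣n′² = *-cancelʳ-∣ (g ²) {{m*n≢0 g g}}
      (subst₂ _∣_ (trans (cong _² m≡m′g) ([m*n]²≡m²*n² m′ g))
                  (trans (cong _² n≡n′g) ([m*n]²≡m²*n² n′ g)) m²∣n²)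
    m′≡1 : m′ ≡ 1
    m′≡1 = cop (∣-refl , coprime-divisor cop (∣-trans (m∣m*n m′) m′²∣n′²))
    m≡g : m ≡ g
    m≡g = trans m≡m′g (trans (cong (_* g) m′≡1) (*-identityˡ g))

  odd≤odd⇒even-gap : ∀ {m n} → Odd m → Odd n → m ≤ n → ∃[ v ] n ≡ m + 2 * v
  odd≤odd⇒even-gap (i , refl) (l , refl) m≤n with m≤n⇒∃[o]m+o≡n {i} {l} (*-cancelˡ-≤ 2 (s≤s⁻¹ m≤n))
  ... | v , refl = v , identity i v
    where
    identity : ∀ i v → 1 + 2 * (i + v) ≡ 1 + 2 * i + 2 * v
    identity = solve-∀

  -- a = m² − n², written without truncated subtraction.
  record PythagoreanParameters (a b c : ℕ) : Set where
    field
      m n     : ℕ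
      coprime : Coprime m n
      a+n²≡m² : a + n ² ≡ m ²
      b≡2mn   : b ≡ 2 * m * n
      c≡m²+n² : c ≡ m ² + n ²

  -- With b = 2j and c = a + 2v one gets j² = (a + v) v, a product of coprime factors.
  pythagorean-parameters : ∀ {a b c} → a ² + b ² ≡ c ² → Coprime a b → Odd a → Even b → 0 < b →
                           PythagoreanParameters a b c
  pythagorean-parameters {a} {b} {c} eq cop a-odd b-even@(j , refl) b>0 = record
    { m = m ; n = n
    ; coprime = coprime-∣ cop′ (subst (m ∣_) (sym a+v≡m²) (m∣m*n m)) (subst (n ∣_) (sym v≡n²) (m∣m*n n))
    ; a+n²≡m² = trans (cong (a +_) (sym v≡n²)) a+v≡m²
    ; b≡2mn = trans (cong (2 *_) j≡mn) (sym (*-assoc 2 m n))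
    ; c≡m²+n² = trans c≡a+2v (trans (identity₂ a v) (cong₂ _+_ a+v≡m² v≡n²))
    }
    where
    c-odd : Odd c
    c-odd = odd²⇒odd (subst Odd eq (odd+even (odd² a-odd) (even² b-even)))
    a<c : a < c
    a<c = ²-cancel-< (subst (a ² <_) eq (m<m+n (a ²) (²-mono-< b>0)))
    gap = odd≤odd⇒even-gap a-odd c-odd (<⇒≤ a<c)
    v = proj₁ gap
    c≡a+2v : c ≡ a + 2 * v
    c≡a+2v = proj₂ gap
    identity₁ : ∀ a v → (a + 2 * v) * (a + 2 * v) ≡ a * a + 4 * ((a + v) * v)
    identity₁ = solve-∀
    identity₂ : ∀ a v → a + 2 * v ≡ (a + v) + v
    identity₂ = solve-∀
    j²≡[a+v]v : j ² ≡ (a + v) * v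
    j²≡[a+v]v = *-cancelˡ-≡ _ _ 4 (+-cancelˡ-≡ (a ²) _ _
      (trans (cong (a ² +_) (sym ([2*n]²≡4*n² j))) (trans eq (trans (cong _² c≡a+2v) (identity₁ a v)))))
    cop′ : Coprime (a + v) v
    cop′ {d} (d∣a+v , d∣v) = cop (d∣a , coprime-factors cop (∣m⇒∣m*n b d∣a , d∣b²))
      where
      d∣a : d ∣ a
      d∣a = ∣m+n∣m⇒∣n (subst (d ∣_) (+-comm a v) d∣a+v) d∣v
      d∣b² : d ∣ b ²
      d∣b² = subst (d ∣_) (trans (cong (4 *_) (sym j²≡[a+v]v)) (sym ([2*n]²≡4*n² j)))
                   (∣n⇒∣m*n 4 (∣m⇒∣m*n v d∣a+v))
    squares = coprime*≡²⇒squares {w = j} cop′ (sym j²≡[a+v]v)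
    m = proj₁ (proj₁ squares)
    n = proj₁ (proj₂ squares)
    a+v≡m² : a + v ≡ m ²
    a+v≡m² = proj₂ (proj₁ squares)
    v≡n² : v ≡ n ²
    v≡n² = proj₂ (proj₂ squares)
    j≡mn : j ≡ m * n
    j≡mn = ²-injective (trans j²≡[a+v]v (trans (cong₂ _*_ a+v≡m² v≡n²) (sym ([m*n]²≡m²*n² m n))))

  record QuarticSolution (z : ℕ) : Set where
    constructor solution
    field
      x y      : ℕ
      x>0      : 0 < x
      y>0      : 0 < y
      x⁴+y⁴≡z² : x ² ² + y ² ² ≡ z ²

  HasSmallerSolution : ℕ → Set
  HasSmallerSolution z = ∃[ w ] w < z × QuarticSolution w

  -- Parametrise (x², y², z) as m² − n², 2mn, m² + n², then (x, n, m) as r² − s², 2rs, r² + s²;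
  -- m, r and s turn out to be squares, and (√r, √s, √m) is the smaller solution.
  primitive-descent : ∀ {x y z} → 0 < x → 0 < y → Coprime x y → Odd x → Even y →
                      x ² ² + y ² ² ≡ z ² → HasSmallerSolution z
  primitive-descent {x} {y} {z} x>0 y>0 cop x-odd y-even@(y′ , refl) eq =
    c , c<z , solution a b a>0 b>0 a⁴+b⁴≡c²
    where
    module P = PythagoreanParameters
      (pythagorean-parameters {c = z} eq (coprime-² cop) (odd² x-odd) (even² y-even) (²-mono-< y>0))
    n>0 : 0 < P.n
    n>0 = proj₂ (*-positive⇒positive {2 * P.m} (subst (0 <_) P.b≡2mn (²-mono-< y>0)))
    n-even : Even P.n
    n-even with even-or-odd P.n
    ... | inj₁ n-even = n-even
    ... | inj₂ n-odd  = contradiction P.a+n²≡m² (odd²+odd²≢² {c = P.m} x-odd n-odd)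
    cop-xn : Coprime x P.n
    cop-xn {d} (d∣x , d∣n) = P.coprime (d∣m , d∣n)
      where
      d∣m : d ∣ P.m
      d∣m = coprime-factors (coprime-sym P.coprime)
        (∣m⇒∣m*n P.m d∣n , subst (d ∣_) P.a+n²≡m² (∣m∣n⇒∣m+n (∣m⇒∣m*n x d∣x) (∣m⇒∣m*n P.n d∣n)))
    module Q = PythagoreanParameters (pythagorean-parameters {c = P.m} P.a+n²≡m² cop-xn x-odd n-even n>0)
    n≡2[rs] : P.n ≡ 2 * (Q.m * Q.n)
    n≡2[rs] = trans Q.b≡2mn (*-assoc 2 Q.m Q.n)
    y′²≡m[rs] : y′ ² ≡ P.m * (Q.m * Q.n)
    y′²≡m[rs] = *-cancelˡ-≡ _ _ 4
      (trans (sym ([2*n]²≡4*n² y′)) (trans P.b≡2mn (trans (cong (2 * P.m *_) n≡2[rs]) (identity P.m (Q.m * Q.n)))))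
      where
      identity : ∀ m t → 2 * m * (2 * t) ≡ 4 * (m * t)
      identity = solve-∀
    cop-m-rs : Coprime P.m (Q.m * Q.n)
    cop-m-rs (d∣m , d∣rs) = P.coprime (d∣m , subst (_ ∣_) (sym n≡2[rs]) (∣n⇒∣m*n 2 d∣rs))
    outer = coprime*≡²⇒squares {w = y′} cop-m-rs (sym y′²≡m[rs])
    c = proj₁ (proj₁ outer)
    m≡c² : P.m ≡ c ²
    m≡c² = proj₂ (proj₁ outer)
    inner = coprime*≡²⇒squares {w = proj₁ (proj₂ outer)} Q.coprime (proj₂ (proj₂ outer))
    a = proj₁ (proj₁ inner)
    b = proj₁ (proj₂ inner)
    r≡a² : Q.m ≡ a ²
    r≡a² = proj₂ (proj₁ inner)
    s≡b² : Q.n ≡ b ²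
    s≡b² = proj₂ (proj₂ inner)
    a⁴+b⁴≡c² : a ² ² + b ² ² ≡ c ²
    a⁴+b⁴≡c² = trans (cong₂ (λ r s → r ² + s ²) (sym r≡a²) (sym s≡b²)) (trans (sym Q.c≡m²+n²) m≡c²)
    r,s>0 : 0 < Q.m × 0 < Q.n
    r,s>0 = *-positive⇒positive (proj₂ (*-positive⇒positive {2} (subst (0 <_) n≡2[rs] n>0)))
    a>0 : 0 < a
    a>0 = proj₁ (*-positive⇒positive (subst (0 <_) r≡a² (proj₁ r,s>0)))
    b>0 : 0 < b
    b>0 = proj₁ (*-positive⇒positive (subst (0 <_) s≡b² (proj₂ r,s>0)))
    c<z : c < z
    c<z = begin-strict
      c             ≤⟨ n≤n² c ⟩
      c ²           ≡⟨ m≡c² ⟨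
      P.m           ≤⟨ n≤n² P.m ⟩
      P.m ²         <⟨ m<m+n (P.m ²) (²-mono-< n>0) ⟩
      P.m ² + P.n ² ≡⟨ P.c≡m²+n² ⟨
      z             ∎
      where open ≤-Reasoning

  coprime-descent : ∀ {x y z} → 0 < x → 0 < y → Coprime x y → x ² ² + y ² ² ≡ z ² → HasSmallerSolution z
  coprime-descent {x} {y} {z} x>0 y>0 cop eq with even-or-odd x | even-or-odd y
  ... | inj₁ (k , x≡2k) | inj₁ (l , y≡2l) =
    contradiction (cop (divides k (trans x≡2k (*-comm 2 k)) , divides l (trans y≡2l (*-comm 2 l)))) λ ()
  ... | inj₂ x-odd | inj₂ y-odd = contradiction eq (odd²+odd²≢² {c = z} (odd² x-odd) (odd² y-odd))
  ... | inj₂ x-odd | inj₁ y-even = primitive-descent x>0 y>0 cop x-odd y-even eq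
  ... | inj₁ x-even | inj₂ y-odd =
    primitive-descent y>0 x>0 (coprime-sym cop) y-odd x-even (trans (+-comm (y ² ²) (x ² ²)) eq)

  -- With g = gcd x y, the equation reads (x′⁴ + y′⁴) g⁴ = z², so g² ∣ z.
  common-factor-descent : ∀ {x y z} → 0 < x → 0 < y → 1 < gcd x y → x ² ² + y ² ² ≡ z ² → HasSmallerSolution z
  common-factor-descent {x} {y} {z} x>0 y>0 g>1 eq
    with gcd[m,n]∣m x y | gcd[m,n]∣n x y
  ... | divides x′ x≡x′g | divides y′ y≡y′g =
    z′ , z′<z , solution x′ y′ (positive-factor x≡x′g x>0) (positive-factor y≡y′g y>0) x′⁴+y′⁴≡z′²
    where
    g = gcd x y
    instance
      g≢0 : NonZero g
      g≢0 = >-nonZero (<-trans z<s g>1)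
    positive-factor : ∀ {n n′ k} → n ≡ n′ * k → 0 < n → 0 < n′
    positive-factor n≡n′k n>0 = proj₁ (*-positive⇒positive (subst (0 <_) n≡n′k n>0))
    identity : ∀ x′ y′ g → (x′ * g) * (x′ * g) * ((x′ * g) * (x′ * g))
                           + (y′ * g) * (y′ * g) * ((y′ * g) * (y′ * g))
                          ≡ (x′ * x′ * (x′ * x′) + y′ * y′ * (y′ * y′)) * (g * g * (g * g))
    identity = solve-∀
    K = x′ ² ² + y′ ² ²
    Kg⁴≡z² : K * g ² ² ≡ z ²
    Kg⁴≡z² = trans (sym (identity x′ y′ g)) (subst₂ (λ x y → x ² ² + y ² ² ≡ z ²) x≡x′g y≡y′g eq)
    g²∣z : g ² ∣ z
    g²∣z = ²∣²⇒∣ (divides K (sym Kg⁴≡z²))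
    z′ = quotient g²∣z
    z≡z′g² : z ≡ z′ * g ²
    z≡z′g² = m∣n⇒n≡quotient*m g²∣z
    x′⁴+y′⁴≡z′² : K ≡ z′ ²
    x′⁴+y′⁴≡z′² = *-cancelʳ-≡ K (z′ ²) (g ² ²) {{m*n≢0 (g ²) (g ²) {{m*n≢0 g g}} {{m*n≢0 g g}}}}
      (trans Kg⁴≡z² (trans (cong _² z≡z′g²) ([m*n]²≡m²*n² z′ (g ²))))
    z>0 : 0 < z
    z>0 = ²-cancel-< {0} (subst (0 <_) eq (<-≤-trans (²-mono-< (²-mono-< x>0)) (m≤m+n _ _)))
    z′<z : z′ < z
    z′<z = subst (z′ <_) (sym z≡z′g²)
      (m<m*n z′ (g ²) {{>-nonZero (positive-factor z≡z′g² z>0)}} (<-≤-trans g>1 (n≤n² g)))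

  smaller-solution : ∀ {z} → QuarticSolution z → HasSmallerSolution z
  smaller-solution (solution x y x>0 y>0 eq) with gcd x y in g≡
  ... | 0           = contradiction (gcd[m,n]≡0⇒m≡0 g≡) (>⇒≢ x>0)
  ... | 1           = coprime-descent x>0 y>0 (gcd≡1⇒coprime g≡) eq
  ... | suc (suc _) = common-factor-descent x>0 y>0 (subst (1 <_) (sym g≡) (s≤s (s≤s z≤n))) eq

  no-quartic-solution : ∀ z → ¬ QuarticSolution z
  no-quartic-solution = <-rec _ λ z smaller-has-none s →
    let (w , w<z , s′) = smaller-solution s in smaller-has-none w<z s′

  x⁴+y⁴≢z² : ∀ {x y z} → 0 < x → 0 < y → x ² ² + y ² ² ≢ z ²
  x⁴+y⁴≢z² {x} {y} {z} x>0 y>0 eq = no-quartic-solution z (solution x y x>0 y>0 eq)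

module IntegerPowers where
  open import Data.Nat as ℕ using (ℕ; zero; suc; z≤n; s≤s; z<s; _≥_; _>_)
  import Data.Nat.Properties as ℕ
  open import Data.Nat.Divisibility using (_∣_; divides)
  open import Data.Integer hiding (suc; _≥_; _>_)
  open import Data.Integer.Properties
  open import Data.Integer.Tactic.RingSolver using (solve-∀)
  import Data.Nat.Tactic.RingSolver as ℕ-Solver
  open import Data.Product using (Σ; ∃-syntax; _×_; _,_)
  open import Data.Sum using (_⊎_; inj₁; inj₂)
  open import Relation.Nullary using (¬_; contradiction)
  open import Relation.Binary.PropositionalEquality
  open import Relation.Binary.Definitions using (tri<; tri≈; tri>)
  open import Function using (_∘_)
  open FermatQuartic using (_²; even-or-odd; x⁴+y⁴≢z²)

  pos-^ : ∀ a n → (+ a) ^ n ≡ + (a ℕ.^ n)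
  pos-^ a zero    = refl
  pos-^ a (suc n) = trans (cong (+ a *_) (pos-^ a n)) (sym (pos-* a (a ℕ.^ n)))

  abs-^ : ∀ u n → ∣ u ^ n ∣ ≡ ∣ u ∣ ℕ.^ n
  abs-^ u zero    = refl
  abs-^ u (suc n) = trans (abs-* u (u ^ n)) (cong (∣ u ∣ ℕ.*_) (abs-^ u n))

  neg-^-even : ∀ u k → (- u) ^ (2 ℕ.* k) ≡ u ^ (2 ℕ.* k)
  neg-^-even u k = begin
    (- u) ^ (2 ℕ.* k) ≡⟨ ^-*-assoc (- u) 2 k ⟨
    ((- u) ^ 2) ^ k   ≡⟨ cong (_^ k) (identity u) ⟩
    (u ^ 2) ^ k       ≡⟨ ^-*-assoc u 2 k ⟩
    u ^ (2 ℕ.* k)     ∎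
    where
    open ≡-Reasoning
    identity : ∀ u → (- u) * ((- u) * 1ℤ) ≡ u * (u * 1ℤ)
    identity = solve-∀

  neg-^-odd : ∀ u k → (- u) ^ (1 ℕ.+ 2 ℕ.* k) ≡ - (u ^ (1 ℕ.+ 2 ℕ.* k))
  neg-^-odd u k = trans (cong (- u *_) (neg-^-even u k)) (sym (neg-distribˡ-* u (u ^ (2 ℕ.* k))))

  ^-even≡pos : ∀ u k → u ^ (2 ℕ.* k) ≡ + (∣ u ∣ ℕ.^ (2 ℕ.* k))
  ^-even≡pos (+ a)     k = pos-^ a (2 ℕ.* k)
  ^-even≡pos -[1+ a ] k = trans (neg-^-even +[1+ a ] k) (pos-^ (suc a) (2 ℕ.* k))

  ℕ-^-cancelʳ-≡ : ∀ {a b} n → .{{ℕ.NonZero n}} → a ℕ.^ n ≡ b ℕ.^ n → a ≡ b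
  ℕ-^-cancelʳ-≡ {a} {b} n eq with ℕ.<-cmp a b
  ... | tri< a<b _ _ = contradiction eq (ℕ.<⇒≢ (ℕ.^-monoˡ-< n a<b))
  ... | tri≈ _ a≡b _ = a≡b
  ... | tri> _ _ b<a = contradiction (sym eq) (ℕ.<⇒≢ (ℕ.^-monoˡ-< n b<a))

  ∣i∣≡∣j∣⇒i≡±j : ∀ i j → ∣ i ∣ ≡ ∣ j ∣ → i ≡ j ⊎ i ≡ - j
  ∣i∣≡∣j∣⇒i≡±j (+ a)     (+ b)     eq = inj₁ (cong +_ eq)
  ∣i∣≡∣j∣⇒i≡±j (+ a)     -[1+ b ] eq = inj₂ (cong +_ eq)
  ∣i∣≡∣j∣⇒i≡±j -[1+ a ] (+ b)     refl = inj₂ refl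
  ∣i∣≡∣j∣⇒i≡±j -[1+ a ] -[1+ b ] eq = inj₁ (cong -[1+_] (ℕ.suc-injective eq))

  i≡-i⇒i≡0 : ∀ i → i ≡ - i → i ≡ 0ℤ
  i≡-i⇒i≡0 +0       _ = refl
  i≡-i⇒i≡0 +[1+ n ] ()
  i≡-i⇒i≡0 -[1+ n ] ()

  ^-odd-injective : ∀ k {u v} → u ^ (1 ℕ.+ 2 ℕ.* k) ≡ v ^ (1 ℕ.+ 2 ℕ.* k) → u ≡ v
  ^-odd-injective k {u} {v} eq with ∣i∣≡∣j∣⇒i≡±j u v ∣u∣≡∣v∣
    where
    p = 1 ℕ.+ 2 ℕ.* k
    ∣u∣≡∣v∣ : ∣ u ∣ ≡ ∣ v ∣
    ∣u∣≡∣v∣ = ℕ-^-cancelʳ-≡ p (trans (sym (abs-^ u p)) (trans (cong ∣_∣ eq) (abs-^ v p)))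
  ... | inj₁ u≡v  = u≡v
  ... | inj₂ refl = trans (cong -_ v≡0) (sym v≡0)
    where
    v≡0 : v ≡ 0ℤ
    v≡0 = i^n≡0⇒i≡0 v (1 ℕ.+ 2 ℕ.* k) (i≡-i⇒i≡0 _ (trans (sym eq) (neg-^-odd v k)))

  i+j≡0⇒i≡-j : ∀ i j → i + j ≡ 0ℤ → i ≡ - j
  i+j≡0⇒i≡-j i j eq = trans (identity i j) (trans (cong (_+ - j) eq) (+-identityˡ (- j)))
    where
    identity : ∀ i j → i ≡ (i + j) + - j
    identity = solve-∀

  odd-power-sum≡0⇒sum≡0 : ∀ k u v → u ^ (1 ℕ.+ 2 ℕ.* k) + v ^ (1 ℕ.+ 2 ℕ.* k) ≡ 0ℤ → u + v ≡ 0ℤ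
  odd-power-sum≡0⇒sum≡0 k u v eq = trans (cong (_+ v) u≡-v) (+-inverseˡ v)
    where
    p = 1 ℕ.+ 2 ℕ.* k
    u≡-v : u ≡ - v
    u≡-v = ^-odd-injective k (trans (i+j≡0⇒i≡-j (u ^ p) (v ^ p) eq) (sym (neg-^-odd v k)))

  [m+n]^p>m^p+n^p : ∀ {m n} p → 0 ℕ.< m → 0 ℕ.< n → 1 ℕ.< p → m ℕ.^ p ℕ.+ n ℕ.^ p ℕ.< (m ℕ.+ n) ℕ.^ p
  [m+n]^p>m^p+n^p {m} {n} (suc q) m>0 n>0 (s≤s q>0) =
    subst (m ℕ.^ suc q ℕ.+ n ℕ.^ suc q ℕ.<_) (sym (ℕ.*-distribʳ-+ ((m ℕ.+ n) ℕ.^ q) m n))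
      (ℕ.+-mono-<-≤ (ℕ.*-monoʳ-< m {{ℕ.>-nonZero m>0}} (ℕ.^-monoˡ-< q {{ℕ.>-nonZero q>0}} (ℕ.m<m+n m n>0)))
                    (ℕ.*-monoʳ-≤ n (ℕ.^-monoˡ-≤ q (ℕ.m≤n+m n m))))

  record PowerSumsVanish (p : ℕ) (a b c : ℤ) : Set where
    constructor _,_
    field
      sum≡0       : a + b + c ≡ 0ℤ
      power-sum≡0 : a ^ p + b ^ p + c ^ p ≡ 0ℤ

  vanish-rotate : ∀ {p a b c} → PowerSumsVanish p a b c → PowerSumsVanish p b c a
  vanish-rotate {p} {a} {b} {c} (sum , power-sum) =
    trans (rotate a b c) sum , trans (rotate (a ^ p) (b ^ p) (c ^ p)) power-sum
    where
    rotate : ∀ a b c → b + c + a ≡ a + b + c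
    rotate = solve-∀

  vanish-swap : ∀ {p a b c} → PowerSumsVanish p a b c → PowerSumsVanish p a c b
  vanish-swap {p} {a} {b} {c} (sum , power-sum) =
    trans (swap a b c) sum , trans (swap (a ^ p) (b ^ p) (c ^ p)) power-sum
    where
    swap : ∀ a b c → a + c + b ≡ a + b + c
    swap = solve-∀

  vanish-neg : ∀ k {a b c} → PowerSumsVanish (1 ℕ.+ 2 ℕ.* k) a b c →
               PowerSumsVanish (1 ℕ.+ 2 ℕ.* k) (- a) (- b) (- c)
  vanish-neg k {a} {b} {c} (sum , power-sum) =
    trans (neg-sum a b c) (cong -_ sum) ,
    trans (cong₂ _+_ (cong₂ _+_ (neg-^-odd a k) (neg-^-odd b k)) (neg-^-odd c k))
          (trans (neg-sum (a ^ p) (b ^ p) (c ^ p)) (cong -_ power-sum))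
    where
    p = 1 ℕ.+ 2 ℕ.* k
    neg-sum : ∀ a b c → - a + - b + - c ≡ - (a + b + c)
    neg-sum = solve-∀

  odd-exponent>2 : ∀ {k} → 0 ℕ.< k → 2 ℕ.< 1 ℕ.+ 2 ℕ.* k
  odd-exponent>2 k>0 = s≤s (ℕ.*-monoʳ-≤ 2 k>0)

  -- Here c = −(a + b), while a^p + b^p < (a + b)^p.
  positive-pair-¬vanish : ∀ k i j c → 0 ℕ.< k → ¬ PowerSumsVanish (1 ℕ.+ 2 ℕ.* k) +[1+ i ] +[1+ j ] c
  positive-pair-¬vanish k i j c k>0 (sum , power-sum) =
    contradiction (+-injective pos-eq) (ℕ.<⇒≢ ([m+n]^p>m^p+n^p p z<s z<s (ℕ.<⇒≤ (odd-exponent>2 k>0))))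
    where
    p = 1 ℕ.+ 2 ℕ.* k
    S = suc i ℕ.+ suc j
    c≡-S : c ≡ - + S
    c≡-S = trans (i+j≡0⇒i≡-j c (+[1+ i ] + +[1+ j ]) (trans (+-comm c _) sum))
                 (cong -_ (sym (pos-+ (suc i) (suc j))))
    pos-eq : + (suc i ℕ.^ p ℕ.+ suc j ℕ.^ p) ≡ + (S ℕ.^ p)
    pos-eq = begin
      + (suc i ℕ.^ p ℕ.+ suc j ℕ.^ p)       ≡⟨ pos-+ (suc i ℕ.^ p) (suc j ℕ.^ p) ⟩
      + (suc i ℕ.^ p) + + (suc j ℕ.^ p)     ≡⟨ cong₂ _+_ (pos-^ (suc i) p) (pos-^ (suc j) p) ⟨
      +[1+ i ] ^ p + +[1+ j ] ^ p            ≡⟨ i+j≡0⇒i≡-j (+[1+ i ] ^ p + +[1+ j ] ^ p) (c ^ p) power-sum ⟩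
      - (c ^ p)                              ≡⟨ cong (λ c → - (c ^ p)) c≡-S ⟩
      - ((- + S) ^ p)                        ≡⟨ cong -_ (neg-^-odd (+ S) k) ⟩
      - - ((+ S) ^ p)                        ≡⟨ neg-involutive _ ⟩
      (+ S) ^ p                              ≡⟨ pos-^ S p ⟩
      + (S ℕ.^ p)                            ∎
      where open ≡-Reasoning

  -- Two of three nonzero integers share a sign; rotate, swap and negate to make them positive.
  nonzero-¬vanish : ∀ k → 0 ℕ.< k → ∀ {a b c} → a ≢ 0ℤ → b ≢ 0ℤ → c ≢ 0ℤ →
                    ¬ PowerSumsVanish (1 ℕ.+ 2 ℕ.* k) a b c
  nonzero-¬vanish k k>0 {+0}       a≢0 _ _ = contradiction refl a≢0
  nonzero-¬vanish k k>0 {b = +0}   _ b≢0 _ = contradiction refl b≢0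
  nonzero-¬vanish k k>0 {c = +0}   _ _ c≢0 = contradiction refl c≢0
  nonzero-¬vanish k k>0 {+[1+ i ]} {+[1+ j ]} {c} _ _ _ =
    positive-pair-¬vanish k i j c k>0
  nonzero-¬vanish k k>0 { -[1+ i ]} { -[1+ j ]} {c} _ _ _ =
    positive-pair-¬vanish k i j (- c) k>0 ∘ vanish-neg k
  nonzero-¬vanish k k>0 {+[1+ i ]} { -[1+ j ]} {+[1+ l ]} _ _ _ =
    positive-pair-¬vanish k i l -[1+ j ] k>0 ∘ vanish-swap
  nonzero-¬vanish k k>0 {+[1+ i ]} { -[1+ j ]} { -[1+ l ]} _ _ _ =
    positive-pair-¬vanish k j l -[1+ i ] k>0 ∘ vanish-neg k ∘ vanish-rotate
  nonzero-¬vanish k k>0 { -[1+ i ]} {+[1+ j ]} {+[1+ l ]} _ _ _ =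
    positive-pair-¬vanish k j l -[1+ i ] k>0 ∘ vanish-rotate
  nonzero-¬vanish k k>0 { -[1+ i ]} {+[1+ j ]} { -[1+ l ]} _ _ _ =
    positive-pair-¬vanish k i l -[1+ j ] k>0 ∘ vanish-neg k ∘ vanish-swap

  odd-divisor-or-4∣ : ∀ {m} → 2 ℕ.< m → (∃[ k ] 0 ℕ.< k × 1 ℕ.+ 2 ℕ.* k ∣ m) ⊎ 4 ∣ m
  odd-divisor-or-4∣ {m} m>2 with even-or-odd m
  ... | inj₂ (suc k , refl) = inj₁ (suc k , z<s , divides 1 (sym (ℕ.*-identityˡ _)))
  ... | inj₂ (zero , refl) = contradiction m>2 λ { (s≤s ()) }
  ... | inj₁ (j , refl) with even-or-odd j
  ...   | inj₁ (i , refl) = inj₂ (divides i (identity i))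
    where
    identity : ∀ i → 2 ℕ.* (2 ℕ.* i) ≡ i ℕ.* 4
    identity = ℕ-Solver.solve-∀
  ...   | inj₂ (suc k , refl) = inj₁ (suc k , z<s , divides 2 refl)
  ...   | inj₂ (zero , refl) = contradiction m>2 λ { (s≤s (s≤s ())) }

  FermatSolution : Set
  FermatSolution =
    Σ ℕ λ m → Σ ℤ λ X → Σ ℤ λ Y → Σ ℤ λ Z → (m > 2 × X * Y * Z ≢ 0ℤ × X ^ m + Y ^ m ≡ Z ^ m)

  record OddFermatSolution : Set where
    constructor odd-solution
    field
      k         : ℕ
      k>0       : 0 ℕ.< k
      U V W     : ℤ
      U≢0       : U ≢ 0ℤ
      V≢0       : V ≢ 0ℤ
      W≢0       : W ≢ 0ℤ
      U^p+V^p≡W^p : U ^ (1 ℕ.+ 2 ℕ.* k) + V ^ (1 ℕ.+ 2 ℕ.* k) ≡ W ^ (1 ℕ.+ 2 ℕ.* k)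

  factors-nonzero : ∀ {X Y Z} → X * Y * Z ≢ 0ℤ → X ≢ 0ℤ × Y ≢ 0ℤ × Z ≢ 0ℤ
  factors-nonzero {X} {Y} {Z} XYZ≢0 =
    (λ { refl → XYZ≢0 refl }) ,
    (λ { refl → XYZ≢0 (trans (cong (_* Z) (*-zeroʳ X)) (*-zeroˡ Z)) }) ,
    (λ { refl → XYZ≢0 (*-zeroʳ (X * Y)) })

  ^-nonzero : ∀ {X} n → X ≢ 0ℤ → X ^ n ≢ 0ℤ
  ^-nonzero {X} n X≢0 Xⁿ≡0 = X≢0 (i^n≡0⇒i≡0 X n Xⁿ≡0)

  fermat-^ : ∀ {X Y Z} e d → X ^ (e ℕ.* d) + Y ^ (e ℕ.* d) ≡ Z ^ (e ℕ.* d) →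
             (X ^ e) ^ d + (Y ^ e) ^ d ≡ (Z ^ e) ^ d
  fermat-^ {X} {Y} {Z} e d eq =
    trans (cong₂ _+_ (^-*-assoc X e d) (^-*-assoc Y e d)) (trans eq (sym (^-*-assoc Z e d)))

  x⁴+y⁴≢z⁴ : ∀ {X Y Z} → X ≢ 0ℤ → Y ≢ 0ℤ → X ^ 4 + Y ^ 4 ≢ Z ^ 4
  x⁴+y⁴≢z⁴ {X} {Y} {Z} X≢0 Y≢0 eq =
    x⁴+y⁴≢z² {z = ∣ Z ∣ ²} (abs-positive X≢0) (abs-positive Y≢0) (+-injective (begin
      + (∣ X ∣ ² ² ℕ.+ ∣ Y ∣ ² ²)         ≡⟨ cong₂ (λ x y → + (x ℕ.+ y)) (^4≡²² ∣ X ∣) (^4≡²² ∣ Y ∣) ⟨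
      + (∣ X ∣ ℕ.^ 4 ℕ.+ ∣ Y ∣ ℕ.^ 4)     ≡⟨ pos-+ (∣ X ∣ ℕ.^ 4) (∣ Y ∣ ℕ.^ 4) ⟩
      + (∣ X ∣ ℕ.^ 4) + + (∣ Y ∣ ℕ.^ 4)   ≡⟨ cong₂ _+_ (^-even≡pos X 2) (^-even≡pos Y 2) ⟨
      X ^ 4 + Y ^ 4                       ≡⟨ eq ⟩
      Z ^ 4                               ≡⟨ ^-even≡pos Z 2 ⟩
      + (∣ Z ∣ ℕ.^ 4)                     ≡⟨ cong +_ (^4≡²² ∣ Z ∣) ⟩
      + (∣ Z ∣ ² ²)                       ∎))
    where
    open ≡-Reasoning
    ^4≡²² : ∀ a → a ℕ.* (a ℕ.* (a ℕ.* (a ℕ.* 1))) ≡ (a ℕ.* a) ℕ.* (a ℕ.* a)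
    ^4≡²² = ℕ-Solver.solve-∀
    abs-positive : ∀ {X} → X ≢ 0ℤ → 0 ℕ.< ∣ X ∣
    abs-positive X≢0 = ℕ.n≢0⇒n>0 (X≢0 ∘ ∣i∣≡0⇒i≡0)

  fermat⇒odd-fermat : FermatSolution → OddFermatSolution
  fermat⇒odd-fermat (m , X , Y , Z , m>2 , XYZ≢0 , eq)
    with factors-nonzero {X} {Y} {Z} XYZ≢0 | odd-divisor-or-4∣ m>2
  ... | X≢0 , Y≢0 , Z≢0 | inj₁ (k , k>0 , divides e refl) =
    odd-solution k k>0 (X ^ e) (Y ^ e) (Z ^ e) (^-nonzero e X≢0) (^-nonzero e Y≢0) (^-nonzero e Z≢0)
                 (fermat-^ {X} {Y} {Z} e (1 ℕ.+ 2 ℕ.* k) eq)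
  ... | X≢0 , Y≢0 , _ | inj₂ (divides e refl) =
    contradiction (fermat-^ {X} {Y} {Z} e 4 eq) (x⁴+y⁴≢z⁴ {Z = Z ^ e} (^-nonzero e X≢0) (^-nonzero e Y≢0))

  product-nonzero : ∀ {X Y Z} → X ≢ 0ℤ → Y ≢ 0ℤ → Z ≢ 0ℤ → X * Y * Z ≢ 0ℤ
  product-nonzero {X} {Y} X≢0 Y≢0 Z≢0 XYZ≡0 with i*j≡0⇒i≡0∨j≡0 (X * Y) XYZ≡0
  ... | inj₂ Z≡0 = Z≢0 Z≡0
  ... | inj₁ XY≡0 with i*j≡0⇒i≡0∨j≡0 X XY≡0
  ...   | inj₁ X≡0 = X≢0 X≡0
  ...   | inj₂ Y≡0 = Y≢0 Y≡0

  -- If one term vanishes, the other two have vanishing odd power sum, hence vanishing sum.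
  vanishing-odd-power-sum⇒nonzero : ∀ k {A B C} → A + B ≢ 0ℤ → A + B + C ≢ 0ℤ →
    A ^ (1 ℕ.+ 2 ℕ.* k) + B ^ (1 ℕ.+ 2 ℕ.* k) + C ^ (1 ℕ.+ 2 ℕ.* k) ≡ 0ℤ →
    A ≢ 0ℤ × B ≢ 0ℤ × C ≢ 0ℤ
  vanishing-odd-power-sum⇒nonzero k {A} {B} {C} A+B≢0 A+B+C≢0 eq =
    (λ { refl → A+B+C≢0 (trans (cong (_+ C) (+-identityˡ B))
                   (odd-power-sum≡0⇒sum≡0 k B C (trans (sym (cong (_+ C ^ p) (+-identityˡ (B ^ p)))) eq))) }) ,
    (λ { refl → A+B+C≢0 (trans (cong (_+ C) (+-identityʳ A))
                   (odd-power-sum≡0⇒sum≡0 k A C (trans (sym (cong (_+ C ^ p) (+-identityʳ (A ^ p)))) eq))) }) ,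
    (λ { refl → A+B≢0 (odd-power-sum≡0⇒sum≡0 k A B (trans (sym (+-identityʳ _)) eq)) })
    where
    p = 1 ℕ.+ 2 ℕ.* k

  -- Integer coordinates of a root x of K_{a,n}: x = A / (A + B) and a = C / (A + B).
  record IntegralRoot : Set where
    constructor integral-root
    field
      n           : ℕ
      A B C       : ℤ
      n≥1         : n ≥ 1
      A+B≢0       : A + B ≢ 0ℤ
      A+B+C≢0     : A + B + C ≢ 0ℤ
      power-sum≡0 : A ^ n + B ^ n + C ^ n ≡ 0ℤ

  -- For even n the power sum is a sum of natural numbers, and for n = 1 it is the sum itself.
  integral-root⇒fermat : IntegralRoot → FermatSolution
  integral-root⇒fermat (integral-root n A B C n≥1 A+B≢0 A+B+C≢0 eq) with even-or-odd n
  ... | inj₁ (k , refl) = contradiction (trans (cong₂ _+_ A≡0 B≡0) refl) A+B≢0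
    where
    ∣A∣ⁿ = ∣ A ∣ ℕ.^ n
    ∣B∣ⁿ = ∣ B ∣ ℕ.^ n
    ∣C∣ⁿ = ∣ C ∣ ℕ.^ n
    natural-sum : ∣A∣ⁿ ℕ.+ ∣B∣ⁿ ℕ.+ ∣C∣ⁿ ≡ 0
    natural-sum = +-injective (begin
      + (∣A∣ⁿ ℕ.+ ∣B∣ⁿ ℕ.+ ∣C∣ⁿ)    ≡⟨ pos-+ (∣A∣ⁿ ℕ.+ ∣B∣ⁿ) ∣C∣ⁿ ⟩
      + (∣A∣ⁿ ℕ.+ ∣B∣ⁿ) + + ∣C∣ⁿ    ≡⟨ cong (_+ + ∣C∣ⁿ) (pos-+ ∣A∣ⁿ ∣B∣ⁿ) ⟩
      + ∣A∣ⁿ + + ∣B∣ⁿ + + ∣C∣ⁿ      ≡⟨ cong₂ _+_ (cong₂ _+_ (^-even≡pos A k) (^-even≡pos B k)) (^-even≡pos C k) ⟨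
      A ^ n + B ^ n + C ^ n         ≡⟨ eq ⟩
      0ℤ                            ∎)
      where open ≡-Reasoning
    A≡0 : A ≡ 0ℤ
    A≡0 = ∣i∣≡0⇒i≡0 (ℕ.m^n≡0⇒m≡0 ∣ A ∣ n (ℕ.m+n≡0⇒m≡0 _ (ℕ.m+n≡0⇒m≡0 _ natural-sum)))
    B≡0 : B ≡ 0ℤ
    B≡0 = ∣i∣≡0⇒i≡0 (ℕ.m^n≡0⇒m≡0 ∣ B ∣ n (ℕ.m+n≡0⇒n≡0 ∣A∣ⁿ (ℕ.m+n≡0⇒m≡0 _ natural-sum)))
  ... | inj₂ (zero , refl) =
    contradiction (trans (sym (cong₂ _+_ (cong₂ _+_ (^-identityʳ A) (^-identityʳ B)) (^-identityʳ C))) eq) A+B+C≢0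
  ... | inj₂ (suc k , refl) with vanishing-odd-power-sum⇒nonzero (suc k) A+B≢0 A+B+C≢0 eq
  ...   | A≢0 , B≢0 , C≢0 =
    n , A , B , - C , odd-exponent>2 z<s , product-nonzero {A} {B} { - C} A≢0 B≢0 (C≢0 ∘ neg-injective) ,
    trans (i+j≡0⇒i≡-j (A ^ n + B ^ n) (C ^ n) eq) (sym (neg-^-odd C (suc k)))

  fermat⇒integral-root : FermatSolution → IntegralRoot
  fermat⇒integral-root s with fermat⇒odd-fermat s
  ... | odd-solution k k>0 U V W U≢0 V≢0 W≢0 eq =
    integral-root p U V (- W) (s≤s z≤n) U+V≢0 U+V-W≢0 power-sum≡0
    where
    p = 1 ℕ.+ 2 ℕ.* k
    power-sum≡0 : U ^ p + V ^ p + (- W) ^ p ≡ 0ℤ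
    power-sum≡0 = trans (cong₂ _+_ eq (neg-^-odd W k)) (+-inverseʳ (W ^ p))
    U+V-W≢0 : U + V + - W ≢ 0ℤ
    U+V-W≢0 sum≡0 = nonzero-¬vanish k k>0 U≢0 V≢0 (W≢0 ∘ neg-injective) (sum≡0 , power-sum≡0)
    U+V≢0 : U + V ≢ 0ℤ
    U+V≢0 U+V≡0 = W≢0 (i^n≡0⇒i≡0 W p (trans (sym eq) (begin
      U ^ p + V ^ p        ≡⟨ cong (λ U → U ^ p + V ^ p) (i+j≡0⇒i≡-j U V U+V≡0) ⟩
      (- V) ^ p + V ^ p    ≡⟨ cong (_+ V ^ p) (neg-^-odd V k) ⟩
      - (V ^ p) + V ^ p    ≡⟨ +-inverseˡ (V ^ p) ⟩
      0ℤ                   ∎)))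
      where open ≡-Reasoning

module ClearingDenominators where
  open import Defs
  open import Data.Nat as ℕ using (ℕ; zero; suc; _≥_)
  import Data.Nat.Properties as ℕ
  open import Data.Integer as ℤ using (ℤ; 0ℤ; 1ℤ; +_; +[1+_]; -[1+_])
  import Data.Integer.Properties as ℤ
  open import Data.Integer.Tactic.RingSolver using (solve-∀)
  open import Data.Rational using (ℚ; mkℚ; 0ℚ; 1ℚ; _+_; _*_; -_; _-_; _÷_; 1/_; NonZero; ≢-nonZero; ↥_; ↧_)
  open import Data.Rational.Properties
  open import Data.Rational.Literals using (fromℤ)
  open import Data.Rational.Unnormalised.Base using (*≡*)
  import Data.Rational.Unnormalised.Properties as ℚᵘ
  open import Algebra.Bundles using (CommutativeMonoid)
  open import Algebra.Properties.CommutativeSemigroup (CommutativeMonoid.commutativeSemigroup *-1-commutativeMonoid)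
    using (interchange)
  open import Data.Product using (Σ; ∃-syntax; _×_; _,_)
  open import Function using (_∘_)
  open import Relation.Binary.PropositionalEquality
  open IntegerPowers using (IntegralRoot; integral-root; ^-nonzero; i+j≡0⇒i≡-j)

  fromℤ-+ : ∀ i j → fromℤ (i ℤ.+ j) ≡ fromℤ i + fromℤ j
  fromℤ-+ i j =
    toℚᵘ-injective (ℚᵘ.≃-trans (*≡* (identity i j)) (ℚᵘ.≃-sym (toℚᵘ-homo-+ (fromℤ i) (fromℤ j))))
    where
    identity : ∀ i j → (i ℤ.+ j) ℤ.* 1ℤ ≡ (i ℤ.* 1ℤ ℤ.+ j ℤ.* 1ℤ) ℤ.* 1ℤ
    identity = solve-∀

  fromℤ-* : ∀ i j → fromℤ (i ℤ.* j) ≡ fromℤ i * fromℤ j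
  fromℤ-* i j = toℚᵘ-injective (ℚᵘ.≃-sym (toℚᵘ-homo-* (fromℤ i) (fromℤ j)))

  fromℤ-neg : ∀ i → fromℤ (ℤ.- i) ≡ - fromℤ i
  fromℤ-neg (+ zero)  = refl
  fromℤ-neg +[1+ n ] = refl
  fromℤ-neg -[1+ n ] = refl

  fromℤ-^ : ∀ i n → fromℤ (i ℤ.^ n) ≡ fromℤ i ^ℚ n
  fromℤ-^ i zero    = refl
  fromℤ-^ i (suc n) = trans (fromℤ-* i (i ℤ.^ n)) (cong (fromℤ i *_) (fromℤ-^ i n))

  fromℤ-injective : ∀ {i j} → fromℤ i ≡ fromℤ j → i ≡ j
  fromℤ-injective = cong ↥_

  fromℤ-nonZero : ∀ {i} → i ≢ 0ℤ → NonZero (fromℤ i)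
  fromℤ-nonZero i≢0 = ≢-nonZero (i≢0 ∘ fromℤ-injective)

  *-denominator : ∀ p → p * fromℤ (↧ p) ≡ fromℤ (↥ p)
  *-denominator p@(mkℚ n d _) =
    toℚᵘ-injective (ℚᵘ.≃-trans (toℚᵘ-homo-* p (fromℤ (↧ p))) (*≡* (identity n d)))
    where
    identity : ∀ n d → (n ℤ.* + suc d) ℤ.* 1ℤ ≡ n ℤ.* + (suc d ℕ.* 1)
    identity n d = trans (ℤ.*-identityʳ _) (cong (λ t → n ℤ.* + t) (sym (ℕ.*-identityʳ (suc d))))

  ^ℚ-distribʳ-* : ∀ p q n → (p * q) ^ℚ n ≡ p ^ℚ n * q ^ℚ n
  ^ℚ-distribʳ-* p q zero    = sym (*-identityˡ 1ℚ)
  ^ℚ-distribʳ-* p q (suc n) =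
    trans (cong ((p * q) *_) (^ℚ-distribʳ-* p q n)) (interchange p q (p ^ℚ n) (q ^ℚ n))

  *-cancelʳ-≡ : ∀ p q r .{{_ : NonZero r}} → p * r ≡ q * r → p ≡ q
  *-cancelʳ-≡ p q r eq = begin
    p              ≡⟨ *-identityʳ p ⟨
    p * 1ℚ         ≡⟨ cong (p *_) (*-inverseʳ r) ⟨
    p * (r * 1/ r) ≡⟨ *-assoc p r (1/ r) ⟨
    p * r * 1/ r   ≡⟨ cong (_* 1/ r) eq ⟩
    q * r * 1/ r   ≡⟨ *-assoc q r (1/ r) ⟩
    q * (r * 1/ r) ≡⟨ cong (q *_) (*-inverseʳ r) ⟩
    q * 1ℚ         ≡⟨ *-identityʳ q ⟩
    q              ∎
    where open ≡-Reasoning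

  p÷q*q≡p : ∀ p q .{{_ : NonZero q}} → p ÷ q * q ≡ p
  p÷q*q≡p p q = trans (*-assoc p (1/ q) q) (trans (cong (p *_) (*-inverseˡ q)) (*-identityʳ p))

  record Clears (a x : ℚ) (A B C : ℤ) : Set where
    field
      A+B≢0    : A ℤ.+ B ≢ 0ℤ
      x-clears : x * fromℤ (A ℤ.+ B) ≡ fromℤ A
      a-clears : a * fromℤ (A ℤ.+ B) ≡ fromℤ C

  module _ {a x A B C} (clears : Clears a x A B C) where
    open Clears clears
    private
      c = fromℤ (A ℤ.+ B)

    [1-x]-clears : (1ℚ - x) * c ≡ fromℤ B
    [1-x]-clears = begin
      (1ℚ - x) * c                   ≡⟨ *-distribʳ-+ c 1ℚ (- x) ⟩
      1ℚ * c + - x * c               ≡⟨ cong₂ _+_ (*-identityˡ c) (sym (neg-distribˡ-* x c)) ⟩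
      c + - (x * c)                  ≡⟨ cong (λ t → c + - t) x-clears ⟩
      c + - fromℤ A                  ≡⟨ trans (fromℤ-+ (A ℤ.+ B) (ℤ.- A)) (cong (_+_ c) (fromℤ-neg A)) ⟨
      fromℤ (A ℤ.+ B ℤ.+ ℤ.- A)      ≡⟨ cong fromℤ (identity A B) ⟩
      fromℤ B                        ∎
      where
      open ≡-Reasoning
      identity : ∀ A B → A ℤ.+ B ℤ.+ ℤ.- A ≡ B
      identity = solve-∀

    K-clears : ∀ n → K a n x * c ^ℚ n ≡ fromℤ (A ℤ.^ n ℤ.+ B ℤ.^ n ℤ.+ C ℤ.^ n)
    K-clears n = begin
      (x ^ℚ n + (1ℚ - x) ^ℚ n + a ^ℚ n) * c ^ℚ n
        ≡⟨ trans (*-distribʳ-+ (c ^ℚ n) (x ^ℚ n + (1ℚ - x) ^ℚ n) (a ^ℚ n))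
                 (cong (_+ a ^ℚ n * c ^ℚ n) (*-distribʳ-+ (c ^ℚ n) (x ^ℚ n) ((1ℚ - x) ^ℚ n))) ⟩
      x ^ℚ n * c ^ℚ n + (1ℚ - x) ^ℚ n * c ^ℚ n + a ^ℚ n * c ^ℚ n
        ≡⟨ cong₂ _+_ (cong₂ _+_ (cleared x-clears) (cleared [1-x]-clears)) (cleared a-clears) ⟩
      fromℤ (A ℤ.^ n) + fromℤ (B ℤ.^ n) + fromℤ (C ℤ.^ n)
        ≡⟨ trans (fromℤ-+ (A ℤ.^ n ℤ.+ B ℤ.^ n) (C ℤ.^ n))
                 (cong (_+ fromℤ (C ℤ.^ n)) (fromℤ-+ (A ℤ.^ n) (B ℤ.^ n))) ⟨
      fromℤ (A ℤ.^ n ℤ.+ B ℤ.^ n ℤ.+ C ℤ.^ n) ∎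
      where
      open ≡-Reasoning
      cleared : ∀ {y Y} → y * c ≡ fromℤ Y → y ^ℚ n * c ^ℚ n ≡ fromℤ (Y ℤ.^ n)
      cleared {y} {Y} y-clears =
        trans (sym (^ℚ-distribʳ-* y c n)) (trans (cong (_^ℚ n) y-clears) (sym (fromℤ-^ Y n)))

    K≡0⇒power-sum≡0 : ∀ n → K a n x ≡ 0ℚ → A ℤ.^ n ℤ.+ B ℤ.^ n ℤ.+ C ℤ.^ n ≡ 0ℤ
    K≡0⇒power-sum≡0 n K≡0 =
      fromℤ-injective (trans (sym (K-clears n)) (trans (cong (_* c ^ℚ n) K≡0) (*-zeroˡ (c ^ℚ n))))

    power-sum≡0⇒K≡0 : ∀ n → A ℤ.^ n ℤ.+ B ℤ.^ n ℤ.+ C ℤ.^ n ≡ 0ℤ → K a n x ≡ 0ℚ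
    power-sum≡0⇒K≡0 n sum≡0 =
      *-cancelʳ-≡ (K a n x) 0ℚ (c ^ℚ n) {{cⁿ≢0}}
        (trans (K-clears n) (trans (cong fromℤ sum≡0) (sym (*-zeroˡ (c ^ℚ n)))))
      where
      cⁿ≢0 : NonZero (c ^ℚ n)
      cⁿ≢0 = subst NonZero (fromℤ-^ (A ℤ.+ B) n) (fromℤ-nonZero (^-nonzero n A+B≢0))

    a≡-1⇒sum≡0 : a ≡ - 1ℚ → A ℤ.+ B ℤ.+ C ≡ 0ℤ
    a≡-1⇒sum≡0 refl = trans (cong (λ C → A ℤ.+ B ℤ.+ C) C≡-[A+B]) (ℤ.+-inverseʳ (A ℤ.+ B))
      where
      C≡-[A+B] : C ≡ ℤ.- (A ℤ.+ B)
      C≡-[A+B] = fromℤ-injective (trans (sym a-clears)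
        (trans (sym (neg-distribˡ-* 1ℚ c)) (trans (cong -_ (*-identityˡ c)) (sym (fromℤ-neg (A ℤ.+ B))))))

    sum≡0⇒a≡-1 : A ℤ.+ B ℤ.+ C ≡ 0ℤ → a ≡ - 1ℚ
    sum≡0⇒a≡-1 sum≡0 = *-cancelʳ-≡ a (- 1ℚ) c {{fromℤ-nonZero A+B≢0}} (begin
      a * c                   ≡⟨ a-clears ⟩
      fromℤ C                 ≡⟨ cong fromℤ (i+j≡0⇒i≡-j C (A ℤ.+ B) (trans (ℤ.+-comm C _) sum≡0)) ⟩
      fromℤ (ℤ.- (A ℤ.+ B))   ≡⟨ fromℤ-neg (A ℤ.+ B) ⟩
      - c                     ≡⟨ cong -_ (*-identityˡ c) ⟨
      - (1ℚ * c)              ≡⟨ neg-distribˡ-* 1ℚ c ⟩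
      - 1ℚ * c                ∎)
      where open ≡-Reasoning

  denominators-clear : ∀ a x → Clears a x (↥ x ℤ.* ↧ a) ((↧ x ℤ.- ↥ x) ℤ.* ↧ a) (↥ a ℤ.* ↧ x)
  denominators-clear a@(mkℚ _ _ _) x@(mkℚ _ _ _) = record
    { A+B≢0    = λ A+B≡0 → denominators≢0 (trans (sym A+B≡dd) A+B≡0)
    ; x-clears = begin
        x * fromℤ (A ℤ.+ B)     ≡⟨ cong (λ t → x * fromℤ t) A+B≡dd ⟩
        x * fromℤ (↧ x ℤ.* ↧ a) ≡⟨ cong (x *_) (fromℤ-* (↧ x) (↧ a)) ⟩
        x * (dx * da)           ≡⟨ *-assoc x dx da ⟨
        x * dx * da             ≡⟨ cong (_* da) (*-denominator x) ⟩
        fromℤ (↥ x) * da        ≡⟨ fromℤ-* (↥ x) (↧ a) ⟨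
        fromℤ A                 ∎
    ; a-clears = begin
        a * fromℤ (A ℤ.+ B)     ≡⟨ cong (λ t → a * fromℤ t) A+B≡dd ⟩
        a * fromℤ (↧ x ℤ.* ↧ a) ≡⟨ cong (a *_) (trans (fromℤ-* (↧ x) (↧ a)) (*-comm dx da)) ⟩
        a * (da * dx)           ≡⟨ *-assoc a da dx ⟨
        a * da * dx             ≡⟨ cong (_* dx) (*-denominator a) ⟩
        fromℤ (↥ a) * dx        ≡⟨ fromℤ-* (↥ a) (↧ x) ⟨
        fromℤ C                 ∎
    }
    where
    open ≡-Reasoning
    A = ↥ x ℤ.* ↧ a
    B = (↧ x ℤ.- ↥ x) ℤ.* ↧ a
    C = ↥ a ℤ.* ↧ x
    dx = fromℤ (↧ x)
    da = fromℤ (↧ a)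
    identity : ∀ p q s → p ℤ.* s ℤ.+ (q ℤ.- p) ℤ.* s ≡ q ℤ.* s
    identity = solve-∀
    A+B≡dd : A ℤ.+ B ≡ ↧ x ℤ.* ↧ a
    A+B≡dd = identity (↥ x) (↧ x) (↧ a)
    denominators≢0 : ↧ x ℤ.* ↧ a ≢ 0ℤ
    denominators≢0 ()

  quotients-clear : ∀ A B C → (A+B≢0 : A ℤ.+ B ≢ 0ℤ) →
                    let instance _ = fromℤ-nonZero A+B≢0 in
                    Clears (fromℤ C ÷ fromℤ (A ℤ.+ B)) (fromℤ A ÷ fromℤ (A ℤ.+ B)) A B C
  quotients-clear A B C A+B≢0 = record
    { A+B≢0 = A+B≢0
    ; x-clears = p÷q*q≡p (fromℤ A) (fromℤ (A ℤ.+ B))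
    ; a-clears = p÷q*q≡p (fromℤ C) (fromℤ (A ℤ.+ B))
    }
    where instance _ = fromℤ-nonZero A+B≢0

  root⇒integral-root : (∃[ a ] ∃[ n ] (a ≢ - 1ℚ × n ≥ 1 × Σ ℚ (λ x → K a n x ≡ 0ℚ))) → IntegralRoot
  root⇒integral-root (a , n , a≢-1 , n≥1 , x , K≡0) =
    integral-root n A B C n≥1 (Clears.A+B≢0 clears) (a≢-1 ∘ sum≡0⇒a≡-1 clears)
                  (K≡0⇒power-sum≡0 clears n K≡0)
    where
    A = ↥ x ℤ.* ↧ a
    B = (↧ x ℤ.- ↥ x) ℤ.* ↧ a
    C = ↥ a ℤ.* ↧ x
    clears : Clears a x A B C
    clears = denominators-clear a x

  integral-root⇒root : IntegralRoot → ∃[ a ] ∃[ n ] (a ≢ - 1ℚ × n ≥ 1 × Σ ℚ (λ x → K a n x ≡ 0ℚ))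
  integral-root⇒root (integral-root n A B C n≥1 A+B≢0 A+B+C≢0 power-sum≡0) =
    fromℤ C ÷ fromℤ (A ℤ.+ B) , n , A+B+C≢0 ∘ a≡-1⇒sum≡0 clears , n≥1 ,
    fromℤ A ÷ fromℤ (A ℤ.+ B) , power-sum≡0⇒K≡0 clears n power-sum≡0
    where
    instance _ = fromℤ-nonZero A+B≢0
    clears = quotients-clear A B C A+B≢0

open import Defs
open import Data.Nat using (ℕ; _≥_; _>_)
open import Data.Integer using (ℤ; 0ℤ; _^_; _*_; _+_)
open import Data.Rational using (ℚ; 0ℚ; 1ℚ; -_)
open import Data.Product using (Σ; _×_; ∃-syntax)
open import Relation.Binary.PropositionalEquality using (_≡_; _≢_)
open import Function using (_∘_)
open import Function.Bundles using (_⇔_; mk⇔)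
open ClearingDenominators using (root⇒integral-root; integral-root⇒root)
open IntegerPowers using (integral-root⇒fermat; fermat⇒integral-root)

mainTheorem1 : (∃[ a ] ∃[ n ] (a ≢ - 1ℚ × n ≥ 1 × Σ ℚ (λ x → K a n x ≡ 0ℚ)))
                 ⇔ (Σ ℕ λ m → Σ ℤ λ X → Σ ℤ λ Y → Σ ℤ λ Z → (m > 2 × X * Y * Z ≢ 0ℤ × X ^ m + Y ^ m ≡ Z ^ m))
mainTheorem1 = mk⇔ (integral-root⇒fermat ∘ root⇒integral-root) (integral-root⇒root ∘ fermat⇒integral-root)
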